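{- Let $n,t,k$ be integers with $n\geq 2t\geq 2$ and $k\geq 2$. Let $u$ be a word of length $t$ over $\Sigma_k=\{0,1,\ldots,k-1\}$. Then $B_k(n,u)\leq A_k(n-2t,0^t)$.
   Context: A word $u$ is a border of $w$ if it is a non-empty proper prefix and proper suffix of $w$. A word $w$ is closed by $u$ if $u$ is a border of $w$ and $u$ occurs exactly twice in $w$ as a factor. $B_k(n,u)$ is the number of length-$n$ words over $\Sigma_k$ closed by $u$. $A_k(m,v)$ is the number of length-$m$ words over $\Sigma_k$ that do not contain $v$ as a factor. $0^t$ denotes the word consisting of $t$ zeros. -}

module Defs where

open import Data.Nat using (ℕ; zero; suc; NonZero; _∸_; _<_; _≟_; _<?_)
open import Data.Fin using (Fin)
import Data.Fin.Properties as FinP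
open import Data.List using (List; []; _∷_; length; take; drop; map; concatMap; filter; replicate; tails)
open import Data.List.Properties using (≡-dec)
open import Data.Product using (_×_)
open import Data.Fin using (zero)
open import Relation.Binary.PropositionalEquality using (_≡_)
open import Relation.Nullary using (Dec; ¬_)
open import Relation.Nullary.Decidable using (_×-dec_; ¬?)
open import Data.List using (allFin)

Word : ℕ → Set
Word k = List (Fin k)

allWords : (k n : ℕ) → List (Word k)
allWords k zero    = [] ∷ []
allWords k (suc n) = concatMap (λ a → map (a ∷_) (allWords k n)) (allFin k)

_≟w_ : ∀ {k} (x y : Word k) → Dec (x ≡ y)
_≟w_ = ≡-dec FinP._≟_

IsPrefix : ∀ {k} → Word k → Word k → Set
IsPrefix u w = take (length u) w ≡ u

IsSuffix : ∀ {k} → Word k → Word k → Set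
IsSuffix u w = drop (length w ∸ length u) w ≡ u

occ : ∀ {k} → Word k → Word k → ℕ
occ u w = length (filter (λ s → take (length u) s ≟w u) (tails w))

IsBorder : ∀ {k} → Word k → Word k → Set
IsBorder u w = (0 < length u) × (length u < length w) × IsPrefix u w × IsSuffix u w

ClosedBy : ∀ {k} → Word k → Word k → Set
ClosedBy w u = IsBorder u w × (occ u w ≡ 2)

closedBy? : ∀ {k} (w u : Word k) → Dec (ClosedBy w u)
closedBy? w u =
  ((0 <? length u) ×-dec ((length u <? length w) ×-dec
    ((take (length u) w ≟w u) ×-dec (drop (length w ∸ length u) w ≟w u))))
  ×-dec (occ u w ≟ 2)

IsFactor : ∀ {k} → Word k → Word k → Set
IsFactor u w = ¬ (occ u w ≡ 0)

B : (k n : ℕ) → Word k → ℕ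
B k n u = length (filter (λ w → closedBy? w u) (allWords k n))

A : (k m : ℕ) → Word k → ℕ
A k m v = length (filter (λ w → ¬? (¬? (occ v w ≟ 0))) (allWords k m))

zeros : ∀ {k} → .{{NonZero k}} → ℕ → Word k
zeros {suc k} t = replicate t zero

module Submission where

-- A word of length n closed by u is u y u with |y| = n - 2t, and y avoids u since u occurs only
-- at the two ends; hence B_k(n,u) ≤ A_k(n - 2t, u).  It remains to show that no word u of length t
-- has more avoiders than the constant word a^t.  For a suffix s of u, compare the number of x of
-- length r with x s avoiding u against the number with x a^|s| avoiding a^t, by induction on r,
-- splitting on the last letter of x.  Exactly one letter extends s to a longer suffix of u; it is
-- matched with the letter a, which extends a^|s|.  Every other letter leaves at most the count
-- for s = [], while for a^t every letter other than a leaves at least that count.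

open import Defs
open import Data.Nat using (ℕ; zero; suc; _+_; _*_; _∸_; _≤_; _<_; _≟_; z≤n; s≤s; NonZero)
open import Data.Nat.ListAction using (sum)
open import Data.Nat.ListAction.Properties using (sum-++)
open import Data.Nat.Properties
open import Algebra.Properties.CommutativeMonoid.Sum +-0-commutativeMonoid
  using (sum-syntax; sum-remove; sum-cong-≗; sum-replicate-zero; ∑-comm)
open import Data.Fin using (Fin; zero; suc; punchIn)
open import Data.Fin.Properties using (punchInᵢ≢i)
open import Data.List
  using (List; []; _∷_; _++_; _∷ʳ_; length; take; drop; replicate; filter; map; concatMap; allFin;
         tabulate; initLast; _∷ʳ′_)
open import Data.List.Properties
  using (++-assoc; ++-identityʳ; ∷ʳ-++; ∷-injective; take-all; length-take; length-replicate;
         length-++; map-++; map-∘; map-tabulate)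
open import Data.List.Relation.Unary.All using (All; _∷_)
open import Data.List.Relation.Unary.All.Properties using (replicate⁺)
open import Data.Product using (_×_; _,_; proj₁; proj₂)
open import Function using (_∘_; id)
open import Level using (Level)
open import Relation.Binary.PropositionalEquality
open import Relation.Nullary using (Dec; yes; no; ¬_; contradiction)
open import Relation.Nullary.Decidable using (¬?)
open import Relation.Unary using (Pred; Decidable)

private
  variable
    a p : Level
    X : Set a
    k n r : ℕ

indicator : {P : Set p} → Dec P → ℕ
indicator (yes _) = 1
indicator (no _)  = 0

indicator-yes : {P : Set p} (P? : Dec P) → P → indicator P? ≡ 1
indicator-yes (yes _) _  = refl
indicator-yes (no ¬P) P  = contradiction P ¬P

indicator-no : {P : Set p} (P? : Dec P) → ¬ P → indicator P? ≡ 0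
indicator-no (yes P) ¬P = contradiction P ¬P
indicator-no (no _)  _  = refl

indicator-mono : ∀ {q} {P : Set p} {Q : Set q} (P? : Dec P) (Q? : Dec Q) → (P → Q) →
                 indicator P? ≤ indicator Q?
indicator-mono (yes P) (yes _) _   = ≤-refl
indicator-mono (yes P) (no ¬Q) P⇒Q = contradiction (P⇒Q P) ¬Q
indicator-mono (no _)  _       _   = z≤n

indicator-¬¬ : {P : Set p} (P? : Dec P) → indicator (¬? (¬? P?)) ≡ indicator P?
indicator-¬¬ (yes _) = refl
indicator-¬¬ (no _)  = refl

length-filter-∷ : {P : Pred X p} (P? : Decidable P) (x : X) (xs : List X) →
                  length (filter P? (x ∷ xs)) ≡ indicator (P? x) + length (filter P? xs)
length-filter-∷ P? x xs with P? x
... | yes _ = refl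
... | no _  = refl

length-filter≡sum : {P : Pred X p} (P? : Decidable P) (xs : List X) →
                    length (filter P? xs) ≡ sum (map (indicator ∘ P?) xs)
length-filter≡sum P? []       = refl
length-filter≡sum P? (x ∷ xs) =
  trans (length-filter-∷ P? x xs) (cong (indicator (P? x) +_) (length-filter≡sum P? xs))

∑-mono : {f g : Fin n → ℕ} → (∀ i → f i ≤ g i) → ∑[ i < n ] f i ≤ ∑[ i < n ] g i
∑-mono {zero}  _   = z≤n
∑-mono {suc n} f≤g = +-mono-≤ (f≤g zero) (∑-mono (f≤g ∘ suc))

∑-point : {f : Fin n → ℕ} (d : Fin n) → (∀ i → i ≢ d → f i ≡ 0) → ∑[ i < n ] f i ≡ f d
∑-point {suc n} {f} d f≡0 = begin
  ∑[ i < suc n ] f i                ≡⟨ sum-remove f ⟩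
  f d + ∑[ j < n ] f (punchIn d j)  ≡⟨ cong (f d +_) (sum-cong-≗ λ j → f≡0 _ (punchInᵢ≢i d j)) ⟩
  f d + ∑[ j < n ] 0                ≡⟨ cong (f d +_) (sum-replicate-zero n) ⟩
  f d + 0                           ≡⟨ +-identityʳ (f d) ⟩
  f d                               ∎
  where open ≡-Reasoning

∑-mono-pivot : {f g : Fin n → ℕ} {y : ℕ} (d e : Fin n) → f d ≤ g e →
               (∀ i → i ≢ d → f i ≤ y) → (∀ i → i ≢ e → y ≤ g i) →
               ∑[ i < n ] f i ≤ ∑[ i < n ] g i
∑-mono-pivot {suc n} {f} {g} d e fd≤ge f≤y y≤g = begin
  ∑[ i < suc n ] f i                ≡⟨ sum-remove f ⟩
  f d + ∑[ j < n ] f (punchIn d j)  ≤⟨ +-mono-≤ fd≤ge (∑-mono rest≤) ⟩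
  g e + ∑[ j < n ] g (punchIn e j)  ≡⟨ sum-remove g ⟨
  ∑[ i < suc n ] g i                ∎
  where
  open ≤-Reasoning
  rest≤ : ∀ j → f (punchIn d j) ≤ g (punchIn e j)
  rest≤ j = ≤-trans (f≤y _ (punchInᵢ≢i d j)) (y≤g _ (punchInᵢ≢i e j))

sum-tabulate : (f : Fin n → ℕ) → sum (tabulate f) ≡ ∑[ i < n ] f i
sum-tabulate {zero}  f = refl
sum-tabulate {suc n} f = cong (f zero +_) (sum-tabulate (f ∘ suc))

-- Sums over all words of a given length

sumWords : ℕ → (Word k → ℕ) → ℕ
sumWords         zero    f = f []
sumWords {k = k} (suc r) f = ∑[ a < k ] sumWords r (λ x → f (a ∷ x))

sumWords-cong : ∀ r {f g : Word k → ℕ} → (∀ x → f x ≡ g x) → sumWords r f ≡ sumWords r g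
sumWords-cong zero    f≡g = f≡g []
sumWords-cong (suc r) f≡g = sum-cong-≗ λ a → sumWords-cong r (f≡g ∘ (a ∷_))

sumWords-mono : ∀ r {f g : Word k → ℕ} → (∀ x → length x ≡ r → f x ≤ g x) →
                sumWords r f ≤ sumWords r g
sumWords-mono zero    f≤g = f≤g [] refl
sumWords-mono (suc r) f≤g = ∑-mono λ a → sumWords-mono r λ x ∣x∣ → f≤g (a ∷ x) (cong suc ∣x∣)

sumWords-zero : ∀ r {f : Word k → ℕ} → (∀ x → length x ≡ r → f x ≡ 0) → sumWords r f ≡ 0
sumWords-zero zero f≡0 = f≡0 [] refl
sumWords-zero {k = k} (suc r) f≡0 =
  trans (sum-cong-≗ λ a → sumWords-zero r λ x ∣x∣ → f≡0 (a ∷ x) (cong suc ∣x∣))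
        (sum-replicate-zero k)

sumWords-point : (u : Word k) {f : Word k → ℕ} →
                 (∀ x → length x ≡ length u → x ≢ u → f x ≡ 0) → sumWords (length u) f ≡ f u
sumWords-point []      f≡0 = refl
sumWords-point (b ∷ u) f≡0 = trans
  (∑-point b λ a a≢b → sumWords-zero (length u) λ x ∣x∣ →
    f≡0 (a ∷ x) (cong suc ∣x∣) (a≢b ∘ proj₁ ∘ ∷-injective))
  (sumWords-point u λ x ∣x∣ x≢u → f≡0 (b ∷ x) (cong suc ∣x∣) (x≢u ∘ proj₂ ∘ ∷-injective))

sumWords-++ : ∀ r s (f : Word k → ℕ) →
              sumWords (r + s) f ≡ sumWords r (λ x → sumWords s (λ y → f (x ++ y)))
sumWords-++ zero    s f = refl
sumWords-++ (suc r) s f = sum-cong-≗ λ a → sumWords-++ r s (f ∘ (a ∷_))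

sumWords-∑ : ∀ r (h : Word k → Fin n → ℕ) →
             sumWords r (λ x → ∑[ i < n ] h x i) ≡ ∑[ i < n ] sumWords r (λ x → h x i)
sumWords-∑ zero    h = refl
sumWords-∑ (suc r) h =
  trans (sum-cong-≗ λ a → sumWords-∑ r (h ∘ (a ∷_))) (∑-comm λ a i → sumWords r (λ x → h (a ∷ x) i))

sumWords-∷ʳ : ∀ r (f : Word k → ℕ) →
              sumWords (suc r) f ≡ ∑[ c < k ] sumWords r (λ x → f (x ∷ʳ c))
sumWords-∷ʳ r f = begin
  sumWords (suc r) f                              ≡⟨ cong (λ n → sumWords n f) (+-comm 1 r) ⟩
  sumWords (r + 1) f                              ≡⟨ sumWords-++ r 1 f ⟩
  sumWords r (λ x → ∑[ c < _ ] f (x ∷ʳ c))        ≡⟨ sumWords-∑ r (λ x c → f (x ∷ʳ c)) ⟩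
  ∑[ c < _ ] sumWords r (λ x → f (x ∷ʳ c))        ∎
  where open ≡-Reasoning

sum-allWords : ∀ r (f : Word k → ℕ) → sum (map f (allWords k r)) ≡ sumWords r f
sum-allWords zero f = +-identityʳ (f [])
sum-allWords {k = k} (suc r) f = begin
  sum (map f (allWords k (suc r)))   ≡⟨ sum-concatMap (allFin k) ⟩
  sum (map byFirst (allFin k))       ≡⟨ cong sum (map-tabulate id byFirst) ⟩
  sum (tabulate byFirst)             ≡⟨ sum-tabulate byFirst ⟩
  sumWords (suc r) f                 ∎
  where
  open ≡-Reasoning
  byFirst : Fin k → ℕ
  byFirst a = sumWords r (f ∘ (a ∷_))
  letterBlock : Fin k → List (Word k)
  letterBlock a = map (a ∷_) (allWords k r)
  sum-concatMap : ∀ as → sum (map f (concatMap letterBlock as)) ≡ sum (map byFirst as)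
  sum-concatMap []       = refl
  sum-concatMap (a ∷ as) = begin
    sum (map f (letterBlock a ++ rest))             ≡⟨ cong sum (map-++ f (letterBlock a) rest) ⟩
    sum (map f (letterBlock a) ++ map f rest)       ≡⟨ sum-++ (map f (letterBlock a)) (map f rest) ⟩
    sum (map f (letterBlock a)) + sum (map f rest)  ≡⟨ cong₂ _+_ first (sum-concatMap as) ⟩
    byFirst a + sum (map byFirst as)                ∎
    where
    rest = concatMap letterBlock as
    first : sum (map f (letterBlock a)) ≡ byFirst a
    first = trans (cong sum (sym (map-∘ (allWords k r)))) (sum-allWords r (f ∘ (a ∷_)))

count-allWords : ∀ r {P : Pred (Word k) p} (P? : Decidable P) →
                 length (filter P? (allWords k r)) ≡ sumWords r (indicator ∘ P?)
count-allWords r P? = trans (length-filter≡sum P? (allWords _ r)) (sum-allWords r _)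

-- Occurrences of a factor

take-++-prefix : (v xs ys : List X) → take (length v) xs ≡ v → take (length v) (xs ++ ys) ≡ v
take-++-prefix []      xs       ys _  = refl
take-++-prefix (b ∷ v) (x ∷ xs) ys eq =
  cong₂ _∷_ (proj₁ (∷-injective eq)) (take-++-prefix v xs ys (proj₂ (∷-injective eq)))

take-length-++ : (xs ys : List X) → take (length xs) (xs ++ ys) ≡ xs
take-length-++ xs ys = take-++-prefix xs xs ys (take-all (length xs) xs ≤-refl)

drop-length-++ : (xs ys : List X) → drop (length xs) (xs ++ ys) ≡ ys
drop-length-++ []       ys = refl
drop-length-++ (x ∷ xs) ys = drop-length-++ xs ys

take-++-∷ : ∀ {c : X} (v xs ys : List X) → All (c ≢_) v →
            take (length v) (xs ++ c ∷ ys) ≡ v → take (length v) xs ≡ v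
take-++-∷ []      xs       ys _           _  = refl
take-++-∷ (b ∷ v) []       ys (c≢b ∷ _)   eq = contradiction (proj₁ (∷-injective eq)) c≢b
take-++-∷ (b ∷ v) (x ∷ xs) ys (_ ∷ c∉v)  eq =
  cong₂ _∷_ (proj₁ (∷-injective eq)) (take-++-∷ v xs ys c∉v (proj₂ (∷-injective eq)))

module _ {k : ℕ} where

  matchesAt : (v w : Word k) → Dec (take (length v) w ≡ v)
  matchesAt v w = take (length v) w ≟w v

  occ-∷ : (v : Word k) (b : Fin k) (w : Word k) →
          occ v (b ∷ w) ≡ indicator (matchesAt v (b ∷ w)) + occ v w
  occ-∷ v b w = length-filter-∷ (matchesAt v) (b ∷ w) _

  prefix⇒1≤occ : (v w : Word k) → take (length v) w ≡ v → 1 ≤ occ v w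
  prefix⇒1≤occ v w match = begin
    1                                       ≡⟨ indicator-yes (matchesAt v w) match ⟨
    indicator (matchesAt v w)               ≤⟨ m≤m+n _ _ ⟩
    indicator (matchesAt v w) + _           ≡⟨ length-filter-∷ (matchesAt v) w _ ⟨
    occ v w                                 ∎
    where open ≤-Reasoning

  occ-self : (v : Word k) → 1 ≤ occ v v
  occ-self v = prefix⇒1≤occ v v (take-all (length v) v ≤-refl)

  short⇒occ≡0 : (v w : Word k) → length w < length v → occ v w ≡ 0
  short⇒occ≡0 (b ∷ v) []      _  = refl
  short⇒occ≡0 v       (c ∷ w) lt = trans (occ-∷ v c w)
    (cong₂ _+_ (indicator-no (matchesAt v (c ∷ w)) no-match)
               (short⇒occ≡0 v w (<-trans (n<1+n _) lt)))
    where
    no-match : take (length v) (c ∷ w) ≢ v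
    no-match eq = <⇒≱ lt (subst (λ x → length x ≤ length (c ∷ w)) eq
                           (≤-trans (≤-reflexive (length-take (length v) (c ∷ w))) (m⊓n≤n _ _)))

  matchesAt-++ : (v x y : Word k) → indicator (matchesAt v x) ≤ indicator (matchesAt v (x ++ y))
  matchesAt-++ v x y = indicator-mono (matchesAt v x) (matchesAt v (x ++ y)) (take-++-prefix v x y)

  occ-++-≤ˡ : (v x y : Word k) → occ v x ≤ occ v (x ++ y)
  occ-++-≤ˡ []      []      y = prefix⇒1≤occ [] y refl
  occ-++-≤ˡ (b ∷ v) []      y = z≤n
  occ-++-≤ˡ v       (c ∷ x) y = begin
    occ v (c ∷ x)                                          ≡⟨ occ-∷ v c x ⟩
    indicator (matchesAt v (c ∷ x)) + occ v x              ≤⟨ +-mono-≤ (matchesAt-++ v (c ∷ x) y)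
                                                                       (occ-++-≤ˡ v x y) ⟩
    indicator (matchesAt v (c ∷ x ++ y)) + occ v (x ++ y)  ≡⟨ occ-∷ v c (x ++ y) ⟨
    occ v (c ∷ x ++ y)                                     ∎
    where open ≤-Reasoning

  occ-++-≤ʳ : (v x y : Word k) → occ v y ≤ occ v (x ++ y)
  occ-++-≤ʳ v []      y = ≤-refl
  occ-++-≤ʳ v (c ∷ x) y =
    ≤-trans (occ-++-≤ʳ v x y) (≤-trans (m≤n+m _ _) (≤-reflexive (sym (occ-∷ v c (x ++ y)))))

  occ-++-superadditive : (v x y : Word k) → 0 < length v → occ v x + occ v y ≤ occ v (x ++ y)
  occ-++-superadditive v []      y 0<∣v∣ = ≤-reflexive (cong (_+ occ v y) (short⇒occ≡0 v [] 0<∣v∣))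
  occ-++-superadditive v (c ∷ x) y 0<∣v∣ = begin
    occ v (c ∷ x) + occ v y                                ≡⟨ cong (_+ occ v y) (occ-∷ v c x) ⟩
    indicator (matchesAt v (c ∷ x)) + occ v x + occ v y    ≡⟨ +-assoc _ (occ v x) (occ v y) ⟩
    indicator (matchesAt v (c ∷ x)) + (occ v x + occ v y)  ≤⟨ +-mono-≤ (matchesAt-++ v (c ∷ x) y)
                                                                       (occ-++-superadditive v x y 0<∣v∣) ⟩
    indicator (matchesAt v (c ∷ x ++ y)) + occ v (x ++ y)  ≡⟨ occ-∷ v c (x ++ y) ⟨
    occ v (c ∷ x ++ y)                                     ∎
    where open ≤-Reasoning

  occ-++-∷ : {c : Fin k} (v x z : Word k) → All (c ≢_) v →
             occ v x ≡ 0 → occ v z ≡ 0 → occ v (x ++ c ∷ z) ≡ 0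
  occ-++-∷ {c} v x z c∉v x-avoids z-avoids = go x x-avoids
    where
    no-match : ∀ x → occ v x ≡ 0 → take (length v) (x ++ c ∷ z) ≢ v
    no-match x x-avoids eq = n>0⇒n≢0 (prefix⇒1≤occ v x (take-++-∷ v x z c∉v eq)) x-avoids
    go : ∀ x → occ v x ≡ 0 → occ v (x ++ c ∷ z) ≡ 0
    go []      x-avoids = trans (occ-∷ v c z)
      (cong₂ _+_ (indicator-no (matchesAt v (c ∷ z)) (no-match [] x-avoids)) z-avoids)
    go (b ∷ x) x-avoids = trans (occ-∷ v b (x ++ c ∷ z))
      (cong₂ _+_ (indicator-no (matchesAt v (b ∷ x ++ c ∷ z)) (no-match (b ∷ x) x-avoids))
                 (go x (m+n≡0⇒n≡0 _ (trans (sym (occ-∷ v b x)) x-avoids))))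

  closedBy-decompose : (u x y z : Word k) → length x ≡ length u → length z ≡ length u →
                       ClosedBy (x ++ y ++ z) u → x ≡ u × z ≡ u × occ u y ≡ 0
  closedBy-decompose u x y z ∣x∣ ∣z∣ ((0<∣u∣ , _ , prefix , suffix) , twice) = x≡u , z≡u , y-avoids
    where
    x≡u : x ≡ u
    x≡u = trans (sym (take-length-++ x (y ++ z)))
                (trans (cong (λ n → take n (x ++ y ++ z)) ∣x∣) prefix)
    ∣xy∣ : length (x ++ y ++ z) ∸ length u ≡ length (x ++ y)
    ∣xy∣ = begin
      length (x ++ y ++ z) ∸ length u        ≡⟨ cong (λ w → length w ∸ length u) (++-assoc x y z) ⟨
      length ((x ++ y) ++ z) ∸ length u      ≡⟨ cong (_∸ length u) (length-++ (x ++ y)) ⟩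
      length (x ++ y) + length z ∸ length u  ≡⟨ cong (λ n → length (x ++ y) + n ∸ length u) ∣z∣ ⟩
      length (x ++ y) + length u ∸ length u  ≡⟨ m+n∸n≡m (length (x ++ y)) (length u) ⟩
      length (x ++ y)                        ∎
      where open ≡-Reasoning
    z≡u : z ≡ u
    z≡u = begin
      z                                       ≡⟨ drop-length-++ (x ++ y) z ⟨
      drop (length (x ++ y)) ((x ++ y) ++ z)  ≡⟨ cong (drop (length (x ++ y))) (++-assoc x y z) ⟩
      drop (length (x ++ y)) (x ++ y ++ z)    ≡⟨ cong (λ n → drop n (x ++ y ++ z)) ∣xy∣ ⟨
      drop (length (x ++ y ++ z) ∸ length u) (x ++ y ++ z)
                                              ≡⟨ suffix ⟩
      u                                       ∎
      where open ≡-Reasoning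
    -- The two ends already account for both occurrences of u.
    bound : occ u u + (occ u y + occ u u) ≤ 2
    bound = begin
      occ u u + (occ u y + occ u u)  ≡⟨ cong₂ (λ x z → occ u x + (occ u y + occ u z)) x≡u z≡u ⟨
      occ u x + (occ u y + occ u z)  ≤⟨ +-monoʳ-≤ (occ u x) (occ-++-superadditive u y z 0<∣u∣) ⟩
      occ u x + occ u (y ++ z)       ≤⟨ occ-++-superadditive u x (y ++ z) 0<∣u∣ ⟩
      occ u (x ++ y ++ z)            ≡⟨ twice ⟩
      2                              ∎
      where open ≤-Reasoning
    y-avoids : occ u y ≡ 0
    y-avoids = middle≡0 (occ u u) (occ u y) (occ-self u) bound
      where
      middle≡0 : ∀ m n → 1 ≤ m → m + (n + m) ≤ 2 → n ≡ 0
      middle≡0 m zero    _   _  = refl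
      middle≡0 m (suc n) 1≤m le =
        contradiction (≤-trans (+-mono-≤ 1≤m (+-mono-≤ (s≤s z≤n) 1≤m)) le) λ { (s≤s (s≤s ())) }

  -- Counting words that avoid a factor

  #avoiding : Word k → Word k → ℕ → ℕ
  #avoiding v s r = sumWords r (λ x → indicator (occ v (x ++ s) ≟ 0))

  #avoiding-suc : ∀ v s r → #avoiding v s (suc r) ≡ ∑[ c < k ] #avoiding v (c ∷ s) r
  #avoiding-suc v s r =
    trans (sumWords-∷ʳ r (λ x → indicator (occ v (x ++ s) ≟ 0)))
          (sum-cong-≗ λ c → sumWords-cong r λ x →
            cong (λ w → indicator (occ v w ≟ 0)) (∷ʳ-++ x c s))

  #avoiding-self : ∀ v r → #avoiding v v r ≡ 0
  #avoiding-self v r = sumWords-zero r λ x _ → indicator-no (occ v (x ++ v) ≟ 0)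
    (n>0⇒n≢0 (≤-trans (occ-self v) (occ-++-≤ʳ v x v)))

  #avoiding-≤-[] : ∀ v s r → #avoiding v s r ≤ #avoiding v [] r
  #avoiding-≤-[] v s r = sumWords-mono r λ x _ →
    indicator-mono (occ v (x ++ s) ≟ 0) (occ v (x ++ []) ≟ 0) λ xs-avoids →
      n≤0⇒n≡0 (subst (λ w → occ v w ≤ 0) (sym (++-identityʳ x))
                     (subst (occ v x ≤_) xs-avoids (occ-++-≤ˡ v x s)))

  proper-suffix-shorter : ∀ (p : Word k) b s {u} → u ≡ p ∷ʳ b ++ s → length s < length u
  proper-suffix-shorter p b s u≡pbs = subst (length s <_)
    (sym (trans (cong length (trans u≡pbs (∷ʳ-++ p b s))) (length-++ p)))
    (m≤n+m (suc (length s)) (length p))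

  occ-replicate-short : (a : Fin k) {i j : ℕ} → i < j → occ (replicate j a) (replicate i a) ≡ 0
  occ-replicate-short a {i} {j} i<j = short⇒occ≡0 (replicate j a) (replicate i a)
    (subst₂ _<_ (sym (length-replicate i)) (sym (length-replicate j)) i<j)

  #avoiding-≤-replicate : (a : Fin k) {u : Word k} (r : ℕ) (p s : Word k) → u ≡ p ++ s →
    #avoiding u s r ≤ #avoiding (replicate (length u) a) (replicate (length s) a) r
  #avoiding-≤-replicate a r p s u≡ps with initLast p
  ... | [] rewrite u≡ps = ≤-trans (≤-reflexive (#avoiding-self s r)) z≤n
  #avoiding-≤-replicate a {u} zero .(p′ ∷ʳ b) s u≡ps | p′ ∷ʳ′ b =
    indicator-mono (occ u s ≟ 0) (occ (replicate (length u) a) (replicate (length s) a) ≟ 0)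
      λ _ → occ-replicate-short a (proper-suffix-shorter p′ b s u≡ps)
  #avoiding-≤-replicate a {u} (suc r) .(p′ ∷ʳ b) s u≡ps | p′ ∷ʳ′ b = begin
    #avoiding u s (suc r)                    ≡⟨ #avoiding-suc u s r ⟩
    ∑[ c < k ] #avoiding u (c ∷ s) r         ≤⟨ ∑-mono-pivot b a extend reset-u reset-aᵗ ⟩
    ∑[ c < k ] #avoiding aᵗ (c ∷ aˢ) r       ≡⟨ #avoiding-suc aᵗ aˢ r ⟨
    #avoiding aᵗ aˢ (suc r)                  ∎
    where
    open ≤-Reasoning
    aᵗ = replicate (length u) a
    aˢ = replicate (length s) a
    extend : #avoiding u (b ∷ s) r ≤ #avoiding aᵗ (a ∷ aˢ) r
    extend = #avoiding-≤-replicate a r p′ (b ∷ s) (trans u≡ps (∷ʳ-++ p′ b s))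
    reset-u : ∀ c → c ≢ b → #avoiding u (c ∷ s) r ≤ #avoiding aᵗ [] r
    reset-u c _ = ≤-trans (#avoiding-≤-[] u (c ∷ s) r)
                          (#avoiding-≤-replicate a r u [] (sym (++-identityʳ u)))
    reset-aᵗ : ∀ c → c ≢ a → #avoiding aᵗ [] r ≤ #avoiding aᵗ (c ∷ aˢ) r
    reset-aᵗ c c≢a = sumWords-mono r λ x _ →
      indicator-mono (occ aᵗ (x ++ []) ≟ 0) (occ aᵗ (x ++ c ∷ aˢ) ≟ 0) λ x-avoids →
        occ-++-∷ aᵗ x aˢ (replicate⁺ (length u) c≢a)
          (trans (cong (occ aᵗ) (sym (++-identityʳ x))) x-avoids)
          (occ-replicate-short a (proper-suffix-shorter p′ b s u≡ps))

  A≡#avoiding : ∀ m (v : Word k) → A k m v ≡ #avoiding v [] m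
  A≡#avoiding m v = trans (count-allWords m (λ w → ¬? (¬? (occ v w ≟ 0)))) (sumWords-cong m λ x →
    trans (indicator-¬¬ (occ v x ≟ 0))
          (cong (λ w → indicator (occ v w ≟ 0)) (sym (++-identityʳ x))))

  B≤#avoiding : ∀ n (u : Word k) → 2 * length u ≤ n → B k n u ≤ #avoiding u [] (n ∸ 2 * length u)
  B≤#avoiding n u 2t≤n = begin
    B k n u                        ≡⟨ cong (λ n → B k n u) t+m+t≡n ⟨
    B k (t + (m + t)) u            ≡⟨ count-allWords (t + (m + t)) (λ w → closedBy? w u) ⟩
    sumWords (t + (m + t)) closed  ≡⟨ split ⟩
    sumWords t (λ x → sumWords m (λ y → sumWords t (λ z → closed (x ++ y ++ z))))
                                   ≡⟨ sumWords-point u first-factor-is-u ⟩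
    sumWords m (λ y → sumWords t (λ z → closed (u ++ y ++ z)))
                                   ≤⟨ sumWords-mono m (λ y _ → middle-avoids y) ⟩
    #avoiding u [] m               ∎
    where
    open ≤-Reasoning
    t = length u
    m = n ∸ 2 * t
    closed : Word k → ℕ
    closed w = indicator (closedBy? w u)
    t+m+t≡n : t + (m + t) ≡ n
    t+m+t≡n = trans (+-comm t (m + t)) (trans (+-assoc m t t)
                (trans (cong (λ l → m + (t + l)) (sym (+-identityʳ t))) (m∸n+n≡m 2t≤n)))
    split : sumWords (t + (m + t)) closed
          ≡ sumWords t (λ x → sumWords m (λ y → sumWords t (λ z → closed (x ++ y ++ z))))
    split = trans (sumWords-++ t (m + t) closed)
                  (sumWords-cong t λ x → sumWords-++ m t (closed ∘ (x ++_)))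
    first-factor-is-u : ∀ x → length x ≡ t → x ≢ u →
                        sumWords m (λ y → sumWords t (λ z → closed (x ++ y ++ z))) ≡ 0
    first-factor-is-u x ∣x∣ x≢u = sumWords-zero m λ y _ → sumWords-zero t λ z ∣z∣ →
      indicator-no (closedBy? (x ++ y ++ z) u) (x≢u ∘ proj₁ ∘ closedBy-decompose u x y z ∣x∣ ∣z∣)
    last-factor-is-u : ∀ y z → length z ≡ t → z ≢ u → closed (u ++ y ++ z) ≡ 0
    last-factor-is-u y z ∣z∣ z≢u = indicator-no (closedBy? (u ++ y ++ z) u)
      (z≢u ∘ proj₁ ∘ proj₂ ∘ closedBy-decompose u u y z refl ∣z∣)
    middle-factor-avoids-u : ∀ y → ClosedBy (u ++ y ++ u) u → occ u (y ++ []) ≡ 0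
    middle-factor-avoids-u y closedBy = trans (cong (occ u) (++-identityʳ y))
      (proj₂ (proj₂ (closedBy-decompose u u y u refl refl closedBy)))
    middle-avoids : ∀ y → sumWords t (λ z → closed (u ++ y ++ z)) ≤ indicator (occ u (y ++ []) ≟ 0)
    middle-avoids y = begin
      sumWords t (λ z → closed (u ++ y ++ z))  ≡⟨ sumWords-point u (last-factor-is-u y) ⟩
      closed (u ++ y ++ u)                     ≤⟨ indicator-mono (closedBy? (u ++ y ++ u) u)
                                                    (occ u (y ++ []) ≟ 0) (middle-factor-avoids-u y) ⟩
      indicator (occ u (y ++ []) ≟ 0)          ∎

-- The bound holds for every t and every k ≥ 1.
lemma7 : (n t k : ℕ) → .{{_ : NonZero k}} → 1 ≤ t → 2 * t ≤ n → 2 ≤ k →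
    (u : Word k) → length u ≡ t →
    B k n u ≤ A k (n ∸ 2 * t) (zeros t)
lemma7 n t (suc k) _ 2t≤n _ u refl = begin
  B (suc k) n u             ≤⟨ B≤#avoiding n u 2t≤n ⟩
  #avoiding u [] m          ≤⟨ #avoiding-≤-replicate zero m u [] (sym (++-identityʳ u)) ⟩
  #avoiding (zeros t) [] m  ≡⟨ A≡#avoiding m (zeros t) ⟨
  A (suc k) m (zeros t)     ∎
  where
  open ≤-Reasoning
  m = n ∸ 2 * t
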